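{- Let $k$ be an odd positive integer such that $5k+2$ is prime. If $k\equiv 0\pmod 3$ and the number $\frac{2(5k+3)}{3}$ is a period of the Fibonacci sequence modulo $5k+2$, then the following three congruences are equivalent: $$F_{5k+3}\equiv 0\pmod{5k+2},\qquad F_{\frac{5k+3}{3}}\equiv 0\pmod{5k+2},\qquad F_{\frac{2(5k+3)}{3}}\equiv 0\pmod{5k+2}.$$ Moreover, if $k\equiv 0\pmod 3$ and $F_{\frac{5k+3}{3}}\equiv 0\pmod{5k+2}$, then the number $\frac{2(5k+3)}{3}$ is a period of the Fibonacci sequence modulo $5k+2$ if and only if $F_{\frac{5k}{3}}\equiv -1\pmod{5k+2}$.
   Context: $(F_n)_{n\ge 0}$ denotes the Fibonacci sequence: $F_0=0$, $F_1=1$, $F_{n+2}=F_{n+1}+F_n$. For an integer $m\ge 2$, a period of the Fibonacci sequence modulo $m$ is a non-zero integer $\ell$ such that $F_{1+\ell}\equiv F_{2+\ell}\equiv 1\pmod m$. -}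

module Defs where

open import Data.Nat using (ℕ; zero; suc; _+_; _*_; _%_; NonZero)
open import Relation.Binary.PropositionalEquality using (_≡_; _≢_)
open import Data.Product using (_×_)

F : ℕ → ℕ
F zero = 0
F (suc zero) = 1
F (suc (suc n)) = F (suc n) + F n

infix 4 _≡_[mod_]
_≡_[mod_] : ℕ → ℕ → (m : ℕ) → .{{NonZero m}} → Set
a ≡ b [mod m ] = a % m ≡ b % m

-- ℓ is a period of the Fibonacci sequence modulo m (ℓ a non-zero natural;
-- the periods considered in the statement are positive)
IsPeriod : (m : ℕ) → .{{NonZero m}} → ℕ → Set
IsPeriod m ℓ = ℓ ≢ 0 × (F (1 + ℓ) ≡ 1 [mod m ]) × (F (2 + ℓ) ≡ 1 [mod m ])

{-# OPTIONS --safe #-}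
-- Put n = (5k + 3)/3, so that n is even and p = 5k + 2 = 3n − 1.  Three facts about
-- the Fibonacci numbers drive everything: the addition formula, Cassini's identity
-- F(n−1)F(n+1) = F(n)² + 1 for even n, and Lucas' congruence F(p−1) + F(p+1) ≡ 1 (mod p),
-- which is the first coordinate of 1 = (φ + ψ)^p ≡ φ^p + ψ^p in ℤ[φ].
-- If 2n is a period then p divides F(2n) = F(n)(F(n+1) + F(n−1)); by Cassini p cannot
-- divide the second factor, so F(n) ≡ 0 and then F(2n) ≡ F(3n) ≡ 0.  Conversely F(n) ≡ 0
-- already makes 2n a period, and reading Lucas' congruence modulo this period
-- (p − 1 = (n − 2) + 2n, p + 1 = n + 2n) gives F(n−2) + F(n) ≡ 1, i.e. F(n−1) ≡ −1.
-- So in both parts every congruence involved holds, and the equivalences follow.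
module Submission where

open import Defs
open import Data.Nat.Base as ℕ using (ℕ; zero; suc; NonZero)
open import Data.Nat.Primality using (Prime; euclidsLemma)
open import Data.Product.Base using (_×_; _,_; proj₁; proj₂)
open import Relation.Binary.PropositionalEquality

module PrimeBinomial where
  open import Data.Nat.Base using (_*_; _∸_; _<_; _!)
  open import Data.Nat.Combinatorics using (_C_; k![n∸k]!∣n!)
  open import Data.Nat.Combinatorics.Specification using (nCk≡n!/k![n-k]!)
  open import Data.Nat.Divisibility using (_∣_; m∣m*n; ∣1⇒≡1; ∣⇒≤)
  open import Data.Nat.DivMod using (_/_; m/n*n≡m)
  open import Data.Nat.Primality using (¬prime[1])
  open import Data.Nat.Properties using (<⇒≱; <⇒≤; <-trans; n<1+n; ∸-monoʳ-<; _!*_!≢0)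
  open import Data.Sum.Base using (inj₁; inj₂; [_,_]′)
  open import Data.Empty using (⊥-elim)
  open import Function.Base using (id; _∘_)
  open import Relation.Nullary using (¬_)

  p∤m! : ∀ {p m} → Prime p → m < p → ¬ p ∣ m !
  p∤m! {m = zero} p-prime _ p∣1 = ¬prime[1] (subst Prime (∣1⇒≡1 p∣1) p-prime)
  p∤m! {m = suc m} p-prime m<p p∣m! with euclidsLemma (suc m) (m !) p-prime p∣m!
  ... | inj₁ p∣1+m = <⇒≱ m<p (∣⇒≤ p∣1+m)
  ... | inj₂ p∣m!′ = p∤m! p-prime (<-trans (n<1+n m) m<p) p∣m!′

  p∣pCk : ∀ {q k} → Prime (suc q) → 0 < k → k < suc q → suc q ∣ suc q C k
  p∣pCk {q} {k} p-prime 0<k k<p =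
    [ id , ⊥-elim ∘ p∤k![p∸k]! ]′ (euclidsLemma (p C k) (k ! * (p ∸ k) !) p-prime p∣pCk*k![p∸k]!)
    where
    open ≡-Reasoning
    p : ℕ
    p = suc q
    p∣pCk*k![p∸k]! : p ∣ (p C k) * (k ! * (p ∸ k) !)
    p∣pCk*k![p∸k]! = subst (p ∣_) (sym (begin
      (p C k) * (k ! * (p ∸ k) !)                                     ≡⟨ cong (_* (k ! * (p ∸ k) !)) (nCk≡n!/k![n-k]! (<⇒≤ k<p)) ⟩
      (p ! / (k ! * (p ∸ k) !)) {{k !* (p ∸ k) !≢0}} * (k ! * (p ∸ k) !) ≡⟨ m/n*n≡m {{k !* (p ∸ k) !≢0}} (k![n∸k]!∣n! (<⇒≤ k<p)) ⟩
      p !                                                             ∎)) (m∣m*n (q !))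
    p∤k![p∸k]! : ¬ p ∣ k ! * (p ∸ k) !
    p∤k![p∸k]! = [ p∤m! p-prime k<p , p∤m! p-prime (∸-monoʳ-< 0<k (<⇒≤ k<p)) ]′ ∘ euclidsLemma (k !) ((p ∸ k) !) p-prime

module FibonacciModP where
  open import Data.Integer.Base using (ℤ; +_; -_; -[1+_]; _+_; _-_; _*_; 0ℤ; 1ℤ; ∣_∣)
  open import Data.Integer.Properties
    using (+-assoc; +-comm; +-identityˡ; +-identityʳ; +-injective; pos-*; neg-distribˡ-*; neg-involutive; abs-*; suc-*)
  open import Data.Integer.Divisibility.Signed
    using (_∣_; divides; ∣ᵤ⇒∣; ∣⇒∣ᵤ; ∣m∣n⇒∣m+n; ∣m∣n⇒∣m-n; ∣m⇒∣-m; ∣n⇒∣m*n; ∣m⇒∣m*n)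
  open import Data.Integer.DivMod using (a≡a%ℕn+[a/ℕn]*n)
  open import Data.Integer.Tactic.RingSolver using (solve-∀)
  import Data.Nat.Properties as ℕ
  import Data.Nat.Divisibility as ℕ
  open import Data.Nat.Divisibility using (>⇒∤)
  open import Data.Nat.DivMod using (_%_; _/_; [m+kn]%n≡m%n)
  open import Data.Nat.Combinatorics using (nCn≡1)
  import Data.Fin.Base as Fin
  open import Data.Fin.Properties using (toℕ-fromℕ; inject₁ℕ<)
  open import Data.Vec.Functional using (Vector; init; tail; last)
  open import Data.Sum.Base using (_⊎_; [_,_]′)
  import Data.Sum.Base as Sum
  open import Data.Empty using (⊥-elim)
  open import Function.Base using (_∘_)
  open import Algebra.Bundles using (CommutativeSemiring)
  open import Algebra.Structures {A = ℤ × ℤ} _≡_ using (IsCommutativeMonoid)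
  open import Algebra.Structures.Biased {A = ℤ × ℤ} _≡_ using (isCommutativeMonoidˡ; isCommutativeSemiringˡ)
  open PrimeBinomial using (p∣pCk)
  open ≡-Reasoning

  f : ℕ → ℤ
  f n = + F n

  f-+ : ∀ m n → f (suc (m ℕ.+ n)) ≡ f (suc m) * f (suc n) + f m * f n
  f-+ zero n = base (f (suc n)) (f n)
    where
    base : ∀ x y → x ≡ 1ℤ * x + 0ℤ * y
    base = solve-∀
  f-+ (suc m) n = begin
    f (suc (suc (m ℕ.+ n)))                   ≡⟨ cong (λ k → f (suc k)) (ℕ.+-suc m n) ⟨
    f (suc (m ℕ.+ suc n))                     ≡⟨ f-+ m (suc n) ⟩
    f (suc m) * f (2 ℕ.+ n) + f m * f (suc n) ≡⟨ step (f (suc m)) (f m) (f (suc n)) (f n) ⟩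
    f (2 ℕ.+ m) * f (suc n) + f (suc m) * f n ∎
    where
    step : ∀ x y u v → x * (u + v) + y * u ≡ (x + y) * u + x * v
    step = solve-∀

  f[2n] : ∀ m → f (2 ℕ.* suc m) ≡ f (suc m) * (f (2 ℕ.+ m) + f m)
  f[2n] m = begin
    f (2 ℕ.* suc m)                                ≡⟨ cong (λ k → f (suc (m ℕ.+ suc k))) (ℕ.+-identityʳ m) ⟩
    f (suc (m ℕ.+ suc m))                          ≡⟨ f-+ m (suc m) ⟩
    f (suc m) * f (2 ℕ.+ m) + f m * f (suc m)      ≡⟨ factor (f (suc m)) (f (2 ℕ.+ m)) (f m) ⟩
    f (suc m) * (f (2 ℕ.+ m) + f m)                ∎
    where
    factor : ∀ x y z → x * y + z * x ≡ x * (y + z)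
    factor = solve-∀

  f[2n+1] : ∀ n → f (suc (2 ℕ.* n)) ≡ f (suc n) * f (suc n) + f n * f n
  f[2n+1] n = trans (cong (λ k → f (suc (n ℕ.+ k))) (ℕ.+-identityʳ n)) (f-+ n n)

  cassini-step : ∀ n → f (suc n) * f (3 ℕ.+ n) - f (2 ℕ.+ n) * f (2 ℕ.+ n)
                     ≡ - (f n * f (2 ℕ.+ n) - f (suc n) * f (suc n))
  cassini-step n = identity (f (suc n)) (f n)
    where
    identity : ∀ x y → x * ((x + y) + x) - (x + y) * (x + y) ≡ - (y * (x + y) - x * x)
    identity = solve-∀

  cassini-odd : ∀ j → f (suc (j ℕ.* 2)) * f (3 ℕ.+ j ℕ.* 2) - f (2 ℕ.+ j ℕ.* 2) * f (2 ℕ.+ j ℕ.* 2) ≡ 1ℤ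
  cassini-odd zero = refl
  cassini-odd (suc j) = begin
    f (3 ℕ.+ e) * f (5 ℕ.+ e) - f (4 ℕ.+ e) * f (4 ℕ.+ e)     ≡⟨ cassini-step (2 ℕ.+ e) ⟩
    - (f (2 ℕ.+ e) * f (4 ℕ.+ e) - f (3 ℕ.+ e) * f (3 ℕ.+ e)) ≡⟨ cong -_ (cassini-step (suc e)) ⟩
    - - (f (suc e) * f (3 ℕ.+ e) - f (2 ℕ.+ e) * f (2 ℕ.+ e)) ≡⟨ neg-involutive _ ⟩
    f (suc e) * f (3 ℕ.+ e) - f (2 ℕ.+ e) * f (2 ℕ.+ e)       ≡⟨ cassini-odd j ⟩
    1ℤ                                                        ∎
    where
    e : ℕ
    e = j ℕ.* 2

  -- Congruences modulo p as divisibility in ℤ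

  module _ {p : ℕ} .{{_ : NonZero p}} where

    ≡[mod]⇒∣ : ∀ {a b} → a ≡ b [mod p ] → + p ∣ + a - + b
    ≡[mod]⇒∣ {a} {b} a≡b = divides (+ (a / p) - + (b / p)) (begin
      + a - + b
        ≡⟨ cong₂ _-_ (a≡a%ℕn+[a/ℕn]*n (+ a) p) (a≡a%ℕn+[a/ℕn]*n (+ b) p) ⟩
      (+ (a % p) + + (a / p) * + p) - (+ (b % p) + + (b / p) * + p)
        ≡⟨ cong (λ r → (+ r + + (a / p) * + p) - (+ (b % p) + + (b / p) * + p)) a≡b ⟩
      (+ (b % p) + + (a / p) * + p) - (+ (b % p) + + (b / p) * + p)
        ≡⟨ cancel (+ (b % p)) (+ (a / p)) (+ (b / p)) (+ p) ⟩
      (+ (a / p) - + (b / p)) * + p ∎)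
      where
      cancel : ∀ r x y m → (r + x * m) - (r + y * m) ≡ (x - y) * m
      cancel = solve-∀

    private
      nonnegative-quotient : ∀ {a b c} → + a - + b ≡ + c * + p → a ≡ b [mod p ]
      nonnegative-quotient {a} {b} {c} eq = begin
        a % p               ≡⟨ cong (_% p) (+-injective a≡b+cp) ⟩
        (b ℕ.+ c ℕ.* p) % p ≡⟨ [m+kn]%n≡m%n b c p ⟩
        b % p               ∎
        where
        shift : ∀ x y → x ≡ y + (x - y)
        shift = solve-∀
        a≡b+cp : + a ≡ + (b ℕ.+ c ℕ.* p)
        a≡b+cp = begin
          + a                 ≡⟨ shift (+ a) (+ b) ⟩
          + b + (+ a - + b)   ≡⟨ cong (λ x → + b + x) eq ⟩
          + b + + c * + p     ≡⟨ cong (λ x → + b + x) (pos-* c p) ⟨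
          + (b ℕ.+ c ℕ.* p)   ∎

    ∣⇒≡[mod] : ∀ {a b} → + p ∣ + a - + b → a ≡ b [mod p ]
    ∣⇒≡[mod] {a} {b} (divides (+ c) eq) = nonnegative-quotient {a} {b} {c} eq
    ∣⇒≡[mod] {a} {b} (divides -[1+ c ] eq) = sym (nonnegative-quotient {b} {a} {suc c} (begin
      + b - + a          ≡⟨ swap (+ a) (+ b) ⟩
      - (+ a - + b)      ≡⟨ cong -_ eq ⟩
      - (-[1+ c ] * + p) ≡⟨ neg-distribˡ-* -[1+ c ] (+ p) ⟩
      + suc c * + p      ∎))
      where
      swap : ∀ x y → y - x ≡ - (x - y)
      swap = solve-∀

    ≡0[mod]⇒∣ : ∀ {a} → a ≡ 0 [mod p ] → + p ∣ + a
    ≡0[mod]⇒∣ {a} a≡0 = subst (+ p ∣_) (+-identityʳ (+ a)) (≡[mod]⇒∣ a≡0)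

    ∣⇒≡0[mod] : ∀ {a} → + p ∣ + a → a ≡ 0 [mod p ]
    ∣⇒≡0[mod] {a} p∣a = ∣⇒≡[mod] (subst (+ p ∣_) (sym (+-identityʳ (+ a))) p∣a)

  euclidsLemmaℤ : ∀ x y {p} → Prime p → + p ∣ x * y → (+ p ∣ x) ⊎ (+ p ∣ y)
  euclidsLemmaℤ x y p-prime p∣xy =
    Sum.map ∣ᵤ⇒∣ ∣ᵤ⇒∣ (euclidsLemma ∣ x ∣ ∣ y ∣ p-prime (subst (_ ℕ.∣_) (abs-* x y) (∣⇒∣ᵤ p∣xy)))

  -- Lucas' congruence via the ring ℤ[φ]

  ℤ[φ] : Set
  ℤ[φ] = ℤ × ℤ

  infixl 6 _⊕_
  infixl 7 _⊗_

  _⊕_ : ℤ[φ] → ℤ[φ] → ℤ[φ]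
  (a , b) ⊕ (c , d) = (a + c , b + d)

  -- (a , b) stands for a + bφ; the product uses φ² = 1 + φ.
  _⊗_ : ℤ[φ] → ℤ[φ] → ℤ[φ]
  (a , b) ⊗ (c , d) = (a * c + b * d , a * d + b * c + b * d)

  𝟎 𝟏 : ℤ[φ]
  𝟎 = (0ℤ , 0ℤ)
  𝟏 = (1ℤ , 0ℤ)

  ⊕-isCommutativeMonoid : IsCommutativeMonoid _⊕_ 𝟎
  ⊕-isCommutativeMonoid = isCommutativeMonoidˡ record
    { isSemigroup = record
      { isMagma = record { isEquivalence = isEquivalence ; ∙-cong = cong₂ _⊕_ }
      ; assoc   = λ (a , b) (c , d) (e , g) → cong₂ _,_ (+-assoc a c e) (+-assoc b d g)
      }
    ; identityˡ = λ (a , b) → cong₂ _,_ (+-identityˡ a) (+-identityˡ b)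
    ; comm      = λ (a , b) (c , d) → cong₂ _,_ (+-comm a c) (+-comm b d)
    }

  ⊗-isCommutativeMonoid : IsCommutativeMonoid _⊗_ 𝟏
  ⊗-isCommutativeMonoid = isCommutativeMonoidˡ record
    { isSemigroup = record
      { isMagma = record { isEquivalence = isEquivalence ; ∙-cong = cong₂ _⊗_ }
      ; assoc   = λ (a , b) (c , d) (e , g) → cong₂ _,_ (assoc₁ a b c d e g) (assoc₂ a b c d e g)
      }
    ; identityˡ = λ (a , b) → cong₂ _,_ (identityˡ₁ a b) (identityˡ₂ a b)
    ; comm      = λ (a , b) (c , d) → cong₂ _,_ (comm₁ a b c d) (comm₂ a b c d)
    }
    where
    assoc₁ : ∀ a b c d e g → (a * c + b * d) * e + (a * d + b * c + b * d) * g
                           ≡ a * (c * e + d * g) + b * (c * g + d * e + d * g)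
    assoc₁ = solve-∀
    assoc₂ : ∀ a b c d e g → (a * c + b * d) * g + (a * d + b * c + b * d) * e + (a * d + b * c + b * d) * g
                           ≡ a * (c * g + d * e + d * g) + b * (c * e + d * g) + b * (c * g + d * e + d * g)
    assoc₂ = solve-∀
    identityˡ₁ : ∀ a b → 1ℤ * a + 0ℤ * b ≡ a
    identityˡ₁ = solve-∀
    identityˡ₂ : ∀ a b → 1ℤ * b + 0ℤ * a + 0ℤ * b ≡ b
    identityˡ₂ = solve-∀
    comm₁ : ∀ a b c d → a * c + b * d ≡ c * a + d * b
    comm₁ = solve-∀
    comm₂ : ∀ a b c d → a * d + b * c + b * d ≡ c * b + d * a + d * b
    comm₂ = solve-∀

  ℤ[φ]-commutativeSemiring : CommutativeSemiring _ _
  ℤ[φ]-commutativeSemiring = record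
    { isCommutativeSemiring = isCommutativeSemiringˡ record
      { +-isCommutativeMonoid = ⊕-isCommutativeMonoid
      ; *-isCommutativeMonoid = ⊗-isCommutativeMonoid
      ; distribʳ = λ (a , b) (c , d) (e , g) → cong₂ _,_ (distribʳ₁ a b c d e g) (distribʳ₂ a b c d e g)
      ; zeroˡ    = λ (a , b) → cong₂ _,_ (zeroˡ₁ a b) (zeroˡ₂ a b)
      }
    }
    where
    distribʳ₁ : ∀ a b c d e g → (c + e) * a + (d + g) * b ≡ (c * a + d * b) + (e * a + g * b)
    distribʳ₁ = solve-∀
    distribʳ₂ : ∀ a b c d e g → (c + e) * b + (d + g) * a + (d + g) * b
                              ≡ (c * b + d * a + d * b) + (e * b + g * a + g * b)
    distribʳ₂ = solve-∀
    zeroˡ₁ : ∀ a b → 0ℤ * a + 0ℤ * b ≡ 0ℤ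
    zeroˡ₁ = solve-∀
    zeroˡ₂ : ∀ a b → 0ℤ * b + 0ℤ * a + 0ℤ * b ≡ 0ℤ
    zeroˡ₂ = solve-∀

  open CommutativeSemiring ℤ[φ]-commutativeSemiring
    using (semiring; +-monoid; +-rawMonoid)
    renaming (+-identityʳ to ⊕-identityʳ; *-identityˡ to ⊗-identityˡ; *-identityʳ to ⊗-identityʳ)
  open import Algebra.Properties.CommutativeSemiring.Binomial ℤ[φ]-commutativeSemiring
    using (binomialTerm) renaming (theorem to binomial-theorem)
  open import Algebra.Properties.Semiring.Exp semiring using (_^_)
  open import Algebra.Properties.Monoid.Sum +-monoid using (sum; sum-init-last)
  open import Algebra.Definitions.RawMonoid +-rawMonoid using () renaming (_×_ to _⊛_)

  -- ψ = 1 − φ is the other root of x² = x + 1, and φ + ψ = 1.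
  φ ψ : ℤ[φ]
  φ = (0ℤ , 1ℤ)
  ψ = (1ℤ , - 1ℤ)

  φ^ : ∀ n → φ ^ suc n ≡ (f n , f (suc n))
  φ^ zero = refl
  φ^ (suc n) = trans (cong (φ ⊗_) (φ^ n)) (cong₂ _,_ (step₁ (f n) (f (suc n))) (step₂ (f n) (f (suc n))))
    where
    step₁ : ∀ x y → 0ℤ * x + 1ℤ * y ≡ y
    step₁ = solve-∀
    step₂ : ∀ x y → 0ℤ * y + 1ℤ * x + 1ℤ * y ≡ y + x
    step₂ = solve-∀

  ψ^ : ∀ n → ψ ^ n ≡ (f (suc n) , - f n)
  ψ^ zero = refl
  ψ^ (suc n) = trans (cong (ψ ⊗_) (ψ^ n)) (cong₂ _,_ (step₁ (f (suc n)) (f n)) (step₂ (f (suc n)) (f n)))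
    where
    step₁ : ∀ x y → 1ℤ * x + - 1ℤ * - y ≡ x + y
    step₁ = solve-∀
    step₂ : ∀ x y → 1ℤ * - y + - 1ℤ * x + - 1ℤ * - y ≡ - x
    step₂ = solve-∀

  𝟏^ : ∀ n → 𝟏 ^ n ≡ 𝟏
  𝟏^ zero = refl
  𝟏^ (suc n) = cong (𝟏 ⊗_) (𝟏^ n)

  infix 4 _∣²_
  _∣²_ : ℤ → ℤ[φ] → Set
  m ∣² (a , b) = (m ∣ a) × (m ∣ b)

  ∣²-sum : ∀ {m n} (v : Vector ℤ[φ] n) → (∀ i → m ∣² v i) → m ∣² sum v
  ∣²-sum {n = zero} v _ = divides 0ℤ refl , divides 0ℤ refl
  ∣²-sum {n = suc n} v m∣v =
    let (m∣a , m∣b) = m∣v Fin.zero ; (m∣c , m∣d) = ∣²-sum (tail v) (m∣v ∘ Fin.suc)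
    in ∣m∣n⇒∣m+n m∣a m∣c , ∣m∣n⇒∣m+n m∣b m∣d

  ⊛-componentwise : ∀ n a b → n ⊛ (a , b) ≡ (+ n * a , + n * b)
  ⊛-componentwise zero a b = refl
  ⊛-componentwise (suc n) a b =
    trans (cong ((a , b) ⊕_) (⊛-componentwise n a b)) (cong₂ _,_ (sym (suc-* (+ n) a)) (sym (suc-* (+ n) b)))

  ∣²-⊛ : ∀ {m} n x → m ℕ.∣ n → + m ∣² n ⊛ x
  ∣²-⊛ {m} n (a , b) m∣n rewrite ⊛-componentwise n a b =
    ∣m⇒∣m*n a (∣ᵤ⇒∣ {+ m} {+ n} m∣n) , ∣m⇒∣m*n b (∣ᵤ⇒∣ {+ m} {+ n} m∣n)

  p∣F[p-1]+F[p+1]-1 : ∀ {q} → Prime (suc q) → + suc q ∣ f q + f (2 ℕ.+ q) - 1ℤ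
  p∣F[p-1]+F[p+1]-1 {q} p-prime =
    subst (+ p ∣_) (sym F[p-1]+F[p+1]-1≡-M) (∣m⇒∣-m (proj₁ (∣²-sum middle p∣middle)))
    where
    p : ℕ
    p = suc q
    term : Vector ℤ[φ] (suc p)
    term = binomialTerm φ ψ p
    middle : Vector ℤ[φ] q
    middle = init (tail term)
    M : ℤ
    M = proj₁ (sum middle)

    p∣middle : ∀ i → + p ∣² middle i
    p∣middle i = ∣²-⊛ _ _ (p∣pCk p-prime (ℕ.s≤s ℕ.z≤n) (ℕ.s≤s (inject₁ℕ< i)))

    first-term : term Fin.zero ≡ ψ ^ p
    first-term = trans (⊕-identityʳ _) (⊗-identityˡ _)

    last-term : last (tail term) ≡ φ ^ p
    last-term rewrite toℕ-fromℕ q | nCn≡1 p | ℕ.n∸n≡0 q = trans (⊕-identityʳ _) (⊗-identityʳ _)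

    𝟏≡ψ^p+M+φ^p : 𝟏 ≡ ψ ^ p ⊕ (sum middle ⊕ φ ^ p)
    𝟏≡ψ^p+M+φ^p = begin
      𝟏                                                 ≡⟨ 𝟏^ p ⟨
      (φ ⊕ ψ) ^ p                                       ≡⟨ binomial-theorem p φ ψ ⟩
      term Fin.zero ⊕ sum (tail term)                   ≡⟨ cong (term Fin.zero ⊕_) (sum-init-last (tail term)) ⟩
      term Fin.zero ⊕ (sum middle ⊕ last (tail term))   ≡⟨ cong₂ (λ x y → x ⊕ (sum middle ⊕ y)) first-term last-term ⟩
      ψ ^ p ⊕ (sum middle ⊕ φ ^ p)                      ∎

    1≡F[p+1]+M+F[p-1] : 1ℤ ≡ f (2 ℕ.+ q) + (M + f q)
    1≡F[p+1]+M+F[p-1] = trans (cong proj₁ 𝟏≡ψ^p+M+φ^p)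
                              (cong₂ (λ x y → x + (M + y)) (cong proj₁ (ψ^ p)) (cong proj₁ (φ^ q)))

    F[p-1]+F[p+1]-1≡-M : f q + f (2 ℕ.+ q) - 1ℤ ≡ - M
    F[p-1]+F[p+1]-1≡-M = trans (cong (λ x → f q + f (2 ℕ.+ q) - x) 1≡F[p+1]+M+F[p-1]) (cancel (f q) (f (2 ℕ.+ q)) M)
      where
      cancel : ∀ x y m → x + y - (y + (m + x)) ≡ - m
      cancel = solve-∀

  period⇒F[x+ℓ]≡F[x] : ∀ {p ℓ} .{{_ : NonZero p}} → IsPeriod p ℓ → ∀ x → F (x ℕ.+ ℓ) ≡ F x [mod p ]
  period⇒F[x+ℓ]≡F[x] {p} {ℓ} (_ , F[1+ℓ]≡1 , F[2+ℓ]≡1) x = ∣⇒≡[mod] (proj₁ (shift x))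
    where
    difference : ∀ u v → (u + v - 1ℤ) - (u - 1ℤ) ≡ v - 0ℤ
    difference = solve-∀
    sum-of-differences : ∀ u v u′ v′ → (u - u′) + (v - v′) ≡ (u + v) - (u′ + v′)
    sum-of-differences = solve-∀
    shift : ∀ x → (+ p ∣ f (x ℕ.+ ℓ) - f x) × (+ p ∣ f (suc x ℕ.+ ℓ) - f (suc x))
    shift zero = subst (+ p ∣_) (difference (f (suc ℓ)) (f ℓ)) (∣m∣n⇒∣m-n (≡[mod]⇒∣ F[2+ℓ]≡1) (≡[mod]⇒∣ F[1+ℓ]≡1))
               , ≡[mod]⇒∣ F[1+ℓ]≡1
    shift (suc x) = let (h₀ , h₁) = shift x in
      h₁ , subst (+ p ∣_) (sum-of-differences (f (suc x ℕ.+ ℓ)) (f (x ℕ.+ ℓ)) (f (suc x)) (f x)) (∣m∣n⇒∣m+n h₁ h₀)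

  module EvenIndex (j : ℕ) where

    n : ℕ
    n = suc j ℕ.* 2

    private
      a b c : ℤ
      a = f n
      b = f (suc n)
      c = f (suc (j ℕ.* 2))

    cassini : c * b ≡ a * a + 1ℤ
    cassini = begin
      c * b                   ≡⟨ split (c * b) (a * a) ⟩
      a * a + (c * b - a * a) ≡⟨ cong (λ x → a * a + x) (cassini-odd j) ⟩
      a * a + 1ℤ              ∎
      where
      split : ∀ x y → x ≡ y + (x - y)
      split = solve-∀

    f[2n]≡a[b+c] : f (2 ℕ.* n) ≡ a * (b + c)
    f[2n]≡a[b+c] = f[2n] (suc (j ℕ.* 2))

    f[2n+1]-1≡a[3a+c] : f (suc (2 ℕ.* n)) - 1ℤ ≡ a * (a + a + a + c)
    f[2n+1]-1≡a[3a+c] = begin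
      f (suc (2 ℕ.* n)) - 1ℤ                                ≡⟨ cong (_- 1ℤ) (f[2n+1] n) ⟩
      b * b + a * a - 1ℤ                                    ≡⟨ regroup a c ⟩
      a * (a + a + a + c) + (c * b - (a * a + 1ℤ))          ≡⟨ cong (λ x → a * (a + a + a + c) + (x - (a * a + 1ℤ))) cassini ⟩
      a * (a + a + a + c) + (a * a + 1ℤ - (a * a + 1ℤ))     ≡⟨ cancel (a * (a + a + a + c)) (a * a + 1ℤ) ⟩
      a * (a + a + a + c)                                   ∎
      where
      regroup : ∀ a c → (a + c) * (a + c) + a * a - 1ℤ ≡ a * (a + a + a + c) + (c * (a + c) - (a * a + 1ℤ))
      regroup = solve-∀
      cancel : ∀ x y → x + (y - y) ≡ x
      cancel = solve-∀

    b[b+c]-[f[2n+1]-1]≡2 : b * (b + c) - (f (suc (2 ℕ.* n)) - 1ℤ) ≡ + 2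
    b[b+c]-[f[2n+1]-1]≡2 = begin
      b * (b + c) - (f (suc (2 ℕ.* n)) - 1ℤ)   ≡⟨ cong (λ x → b * (b + c) - (x - 1ℤ)) (f[2n+1] n) ⟩
      b * (b + c) - (b * b + a * a - 1ℤ)       ≡⟨ regroup a b c ⟩
      (c * b - (a * a + 1ℤ)) + + 2             ≡⟨ cong (λ x → (x - (a * a + 1ℤ)) + + 2) cassini ⟩
      (a * a + 1ℤ - (a * a + 1ℤ)) + + 2        ≡⟨ cancel (a * a + 1ℤ) (+ 2) ⟩
      + 2                                      ∎
      where
      regroup : ∀ a b c → b * (b + c) - (b * b + a * a - 1ℤ) ≡ (c * b - (a * a + 1ℤ)) + + 2
      regroup = solve-∀
      cancel : ∀ x y → (x - x) + y ≡ y
      cancel = solve-∀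

    period⇒F≡0 : ∀ {p} .{{_ : NonZero p}} → Prime p → 2 ℕ.< p → IsPeriod p (2 ℕ.* n) → F n ≡ 0 [mod p ]
    period⇒F≡0 {p} p-prime 2<p period@(_ , F[1+2n]≡1 , _) =
      [ ∣⇒≡0[mod] , (λ p∣b+c → ⊥-elim (>⇒∤ 2<p (∣⇒∣ᵤ {+ p} {+ 2} (p∣2 p∣b+c)))) ]′ (euclidsLemmaℤ a (b + c) p-prime p∣a[b+c])
      where
      p∣a[b+c] : + p ∣ a * (b + c)
      p∣a[b+c] = subst (+ p ∣_) f[2n]≡a[b+c] (≡0[mod]⇒∣ (period⇒F[x+ℓ]≡F[x] period 0))
      p∣2 : + p ∣ b + c → + p ∣ + 2
      p∣2 p∣b+c = subst (+ p ∣_) b[b+c]-[f[2n+1]-1]≡2 (∣m∣n⇒∣m-n (∣n⇒∣m*n b p∣b+c) (≡[mod]⇒∣ F[1+2n]≡1))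

    F≡0⇒period : ∀ {p} .{{_ : NonZero p}} → F n ≡ 0 [mod p ] → IsPeriod p (2 ℕ.* n)
    F≡0⇒period {p} Fn≡0 = (λ ()) , ∣⇒≡[mod] p∣f[2n+1]-1 , ∣⇒≡[mod] p∣f[2n+2]-1
      where
      p∣a : + p ∣ a
      p∣a = ≡0[mod]⇒∣ Fn≡0
      p∣f[2n+1]-1 : + p ∣ f (suc (2 ℕ.* n)) - 1ℤ
      p∣f[2n+1]-1 = subst (+ p ∣_) (sym f[2n+1]-1≡a[3a+c]) (∣m⇒∣m*n _ p∣a)
      p∣f[2n] : + p ∣ f (2 ℕ.* n)
      p∣f[2n] = subst (+ p ∣_) (sym f[2n]≡a[b+c]) (∣m⇒∣m*n _ p∣a)
      regroup : ∀ u v → (u - 1ℤ) + v ≡ u + v - 1ℤ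
      regroup = solve-∀
      p∣f[2n+2]-1 : + p ∣ f (2 ℕ.+ 2 ℕ.* n) - 1ℤ
      p∣f[2n+2]-1 = subst (+ p ∣_) (regroup (f (suc (2 ℕ.* n))) (f (2 ℕ.* n))) (∣m∣n⇒∣m+n p∣f[2n+1]-1 p∣f[2n])

    F≡0⇒F[n-1]+1≡0 : ∀ {p} .{{_ : NonZero p}} → Prime p → suc p ≡ 3 ℕ.* n → F n ≡ 0 [mod p ] →
                     F (suc (j ℕ.* 2)) ℕ.+ 1 ≡ 0 [mod p ]
    F≡0⇒F[n-1]+1≡0 {p} p-prime p+1≡3n Fn≡0 =
      ∣⇒≡0[mod] (subst (+ p ∣_) (regroup (f (e ℕ.+ 2 ℕ.* n)) (f (3 ℕ.* n)) c (f e))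
        (∣m∣n⇒∣m+n (∣m∣n⇒∣m+n (∣m∣n⇒∣m+n (∣m⇒∣-m lucas) shift₁) shift₂) (∣m∣n⇒∣m+n p∣a p∣a)))
      where
      e = j ℕ.* 2
      p≡1+e+2n : p ≡ suc (e ℕ.+ 2 ℕ.* n)
      p≡1+e+2n = ℕ.suc-injective p+1≡3n
      period : IsPeriod p (2 ℕ.* n)
      period = F≡0⇒period Fn≡0
      lucas : + p ∣ f (e ℕ.+ 2 ℕ.* n) + f (3 ℕ.* n) - 1ℤ
      lucas = subst (λ m → + m ∣ f (e ℕ.+ 2 ℕ.* n) + f (3 ℕ.* n) - 1ℤ) (sym p≡1+e+2n)
                    (p∣F[p-1]+F[p+1]-1 (subst Prime p≡1+e+2n p-prime))
      shift₁ : + p ∣ f (e ℕ.+ 2 ℕ.* n) - f e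
      shift₁ = ≡[mod]⇒∣ (period⇒F[x+ℓ]≡F[x] period e)
      shift₂ : + p ∣ f (3 ℕ.* n) - a
      shift₂ = ≡[mod]⇒∣ (period⇒F[x+ℓ]≡F[x] period n)
      p∣a : + p ∣ a
      p∣a = ≡0[mod]⇒∣ Fn≡0
      regroup : ∀ x y c e → - (x + y - 1ℤ) + (x - e) + (y - (c + e)) + ((c + e) + (c + e)) ≡ c + 1ℤ
      regroup = solve-∀

open FibonacciModP using (period⇒F[x+ℓ]≡F[x]; module EvenIndex)
open import Data.Nat.Base using (_+_; _*_; _<_; s≤s; z≤n)
open import Data.Nat.DivMod using (_/_; m*n/n≡m; _divMod_; result)
open import Data.Nat.Divisibility using (_∣_; divides)
open import Data.Nat.Properties using (+-comm; *-comm)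
open import Data.Nat.Tactic.RingSolver using (solve-∀)
import Data.Fin.Base as Fin
open import Data.Product.Base using (∃-syntax)
open import Data.Empty using (⊥-elim)
open import Function.Base using (const)
open import Function.Bundles using (_⇔_; mk⇔)
open import Relation.Nullary using (¬_)

odd-multiple-of-3 : ∀ {k} → ¬ (2 ∣ k) → 3 ∣ k → ∃[ s ] k ≡ (1 + s * 2) * 3
odd-multiple-of-3 k-odd (divides q refl) with q divMod 2
... | result s Fin.zero q≡2s = ⊥-elim (k-odd (divides (s * 3) (trans (cong (_* 3) q≡2s) (swap s))))
  where
  swap : ∀ s → s * 2 * 3 ≡ s * 3 * 2
  swap = solve-∀
... | result s (Fin.suc Fin.zero) q≡1+2s = s , cong (_* 3) q≡1+2s

/3-exact : ∀ {m} n → m ≡ 3 * n → m / 3 ≡ n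
/3-exact n refl = trans (cong (_/ 3) (*-comm 3 n)) (m*n/n≡m n 3)

module OddMultipleOf3 {k s : ℕ} (k≡3[1+2s] : k ≡ (1 + s * 2) * 3) where
  open EvenIndex (5 * s + 2) using (n)

  2<2+5k : 2 < 2 + 5 * k
  2<2+5k = subst (λ k → 2 < 2 + 5 * k) (sym k≡3[1+2s]) (s≤s (s≤s (s≤s z≤n)))

  5k+3≡3n : 5 * k + 3 ≡ 3 * n
  5k+3≡3n = trans (cong (λ k → 5 * k + 3) k≡3[1+2s]) (identity s)
    where
    identity : ∀ s → 5 * ((1 + s * 2) * 3) + 3 ≡ 3 * (suc (5 * s + 2) * 2)
    identity = solve-∀

  3+5k≡3n : 3 + 5 * k ≡ 3 * n
  3+5k≡3n = trans (+-comm 3 (5 * k)) 5k+3≡3n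

  [5k+3]/3≡n : (5 * k + 3) / 3 ≡ n
  [5k+3]/3≡n = /3-exact n 5k+3≡3n

  2[5k+3]/3≡2n : (2 * (5 * k + 3)) / 3 ≡ 2 * n
  2[5k+3]/3≡2n = /3-exact (2 * n) (trans (cong (2 *_) 5k+3≡3n) (swap n))
    where
    swap : ∀ n → 2 * (3 * n) ≡ 3 * (2 * n)
    swap = solve-∀

  5k/3≡n-1 : (5 * k) / 3 ≡ suc ((5 * s + 2) * 2)
  5k/3≡n-1 = /3-exact _ (trans (cong (5 *_) k≡3[1+2s]) (identity s))
    where
    identity : ∀ s → 5 * ((1 + s * 2) * 3) ≡ 3 * suc ((5 * s + 2) * 2)
    identity = solve-∀

theorem5p33 : (k : ℕ) → ¬ (2 ∣ k) → Prime (5 * k + 2) → 3 ∣ k →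
    (IsPeriod (2 + 5 * k) ((2 * (5 * k + 3)) / 3) →
      ((F (5 * k + 3) ≡ 0 [mod (2 + 5 * k) ]) ⇔ (F ((5 * k + 3) / 3) ≡ 0 [mod (2 + 5 * k) ]))
      × ((F ((5 * k + 3) / 3) ≡ 0 [mod (2 + 5 * k) ]) ⇔ (F ((2 * (5 * k + 3)) / 3) ≡ 0 [mod (2 + 5 * k) ])))
    × ((F ((5 * k + 3) / 3) ≡ 0 [mod (2 + 5 * k) ]) →
      (IsPeriod (2 + 5 * k) ((2 * (5 * k + 3)) / 3) ⇔ (F ((5 * k) / 3) + 1 ≡ 0 [mod (2 + 5 * k) ])))
theorem5p33 k k-odd 5k+2-prime 3∣k =
    (λ period →
      let period′ = subst (IsPeriod (2 + 5 * k)) 2[5k+3]/3≡2n period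
          Fn≡0    = period⇒F≡0 p-prime 2<2+5k period′
      in  mk⇔ (const (F≡0-at (sym [5k+3]/3≡n) Fn≡0))
              (const (F≡0-at (sym 5k+3≡3n) (trans (period⇒F[x+ℓ]≡F[x] period′ n) Fn≡0)))
        , mk⇔ (const (F≡0-at (sym 2[5k+3]/3≡2n) (period⇒F[x+ℓ]≡F[x] period′ 0)))
              (const (F≡0-at (sym [5k+3]/3≡n) Fn≡0)))
  , λ F[5k+3/3]≡0 →
      let Fn≡0 = F≡0-at [5k+3]/3≡n F[5k+3/3]≡0
      in  mk⇔ (const (subst (λ m → F m + 1 ≡ 0 [mod (2 + 5 * k) ]) (sym 5k/3≡n-1)
                              (F≡0⇒F[n-1]+1≡0 p-prime 3+5k≡3n Fn≡0)))
              (const (subst (IsPeriod (2 + 5 * k)) (sym 2[5k+3]/3≡2n) (F≡0⇒period Fn≡0)))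
  where
  s : ℕ
  s = proj₁ (odd-multiple-of-3 k-odd 3∣k)
  open OddMultipleOf3 {k} {s} (proj₂ (odd-multiple-of-3 k-odd 3∣k))
  open EvenIndex (5 * s + 2)

  p-prime : Prime (2 + 5 * k)
  p-prime = subst Prime (+-comm (5 * k) 2) 5k+2-prime

  F≡0-at : ∀ {m m′} → m ≡ m′ → F m ≡ 0 [mod (2 + 5 * k) ] → F m′ ≡ 0 [mod (2 + 5 * k) ]
  F≡0-at = subst (λ m → F m ≡ 0 [mod (2 + 5 * k) ])
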